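{- Let $N\in\mathbb{N}\cup\{\infty\}$ and let $(a_n)_{n=0}^N$ be a sequence of (complex) numbers with $a_n\neq 0$ for all $0\le n\le N$, which is fixed by $\mathcal{L}$. Then $a_0=1$ and, with $k=a_1$, \[ a_n - k(a_{n-1}-a_{n-2}) - a_{n-3} = 0 \] for all $n=1,2,\ldots,N$ (for $n \ge 1$ if $N=\infty$), where $a_{ -1}=a_{ -2}=0$.
   Context: For a sequence $(a_n)$, $\mathcal{L}$ denotes the operator sending $(a_n)$ to $(a_n^2-a_{n-1}a_{n+1})$. A finite sequence $(a_n)_{n=0}^N$ is regarded as a sequence indexed by all integers by setting $a_n=0$ for $n<0$ and $n>N$; it is fixed by $\mathcal{L}$ if $a_n^2-a_{n-1}a_{n+1}=a_n$ for all $n\ge 0$ (for $N=\infty$, $a_n$ is defined for all $n\ge0$ and $a_{ -1}=0$). -}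

module Defs where

open import Level using (_⊔_; suc)
open import Algebra.Bundles using (CommutativeRing)
open import Data.Nat as ℕ using (ℕ; _≤ᵇ_)
open import Data.Integer using (ℤ; +_; -[1+_])
open import Data.Maybe using (Maybe; just; nothing)
open import Data.Bool using (if_then_else_)
open import Data.Product using (∃)
open import Relation.Nullary using (¬_)

-- N ∈ ℕ ∪ {∞}: 'just N' is the finite length-bound N, 'nothing' is ∞.
ℕ∞ : Set
ℕ∞ = Maybe ℕ

data InRange : ℕ∞ → ℕ → Set where
  fin : ∀ {N n} → n ℕ.≤ N → InRange (just N) n
  inf : ∀ {n} → InRange nothing n

record Field c ℓ : Set (suc (c ⊔ ℓ)) where
  field
    commutativeRing : CommutativeRing c ℓ
  open CommutativeRing commutativeRing public
  field
    0≉1     : ¬ (0# ≈ 1#)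
    inverse : ∀ x → ¬ (x ≈ 0#) → ∃ λ y → x * y ≈ 1#

module _ {c ℓ} (F : Field c ℓ) where
  open Field F

  -- The sequence (a_n)_{n=0}^N, viewed as indexed by all integers:
  -- a_m = 0 for m < 0 and for m > N.
  extend : ℕ∞ → (ℕ → Carrier) → ℤ → Carrier
  extend N       a -[1+ _ ] = 0#
  extend nothing a (+ m)    = a m
  extend (just N) a (+ m)   = if m ≤ᵇ N then a m else 0#

  𝓛 : (ℤ → Carrier) → ℤ → Carrier
  𝓛 b m = b m * b m - b (m Data.Integer.- Data.Integer.+ 1) * b (m Data.Integer.+ Data.Integer.+ 1)

  FixedByL : ℕ∞ → (ℕ → Carrier) → Set ℓ
  FixedByL N a = ∀ (n : ℕ) → 𝓛 (extend N a) (+ n) ≈ extend N a (+ n)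

module Submission where

-- The fixed-point equation at n = 0 reads a_0² = a_0, whence a_0 = 1.
-- The key observation is the conservation law
--      a_{m+1} + a_m + a_{m-1} = 1 + k a_m            (m ≥ -1):
-- it holds for m = -1 and m = 0 because a_0 = 1, and if it holds at m then
-- a_m · (law at m+1) follows from the law at m combined with the
-- fixed-point equations at m and m+1, so it propagates while a_m ≠ 0.
-- Subtracting two consecutive instances of the law gives exactly the
-- claimed third-order recurrence.

open import Defs
import Data.Nat as ℕ
open import Data.Nat using (ℕ; suc; zero; _≤ᵇ_)
import Data.Nat.Properties as ℕₚ
open import Data.Integer using (+_)
import Data.Integer as ℤ
open import Data.Bool using (true)
open import Data.Maybe using (just; nothing)
open import Data.Product using (_×_; _,_)
open import Relation.Nullary using (¬_)
open import Relation.Binary.PropositionalEquality as ≡ using (_≡_)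
import Algebra.Properties.Group as GroupProperties
import Relation.Binary.Reasoning.Setoid as SetoidReasoning

module FieldFacts {c ℓ} (F : Field c ℓ) where
  open Field F
  open SetoidReasoning setoid
  open GroupProperties +-group
    using (x≈y⇒x∙y⁻¹≈ε; x≈z//y; //-rightDividesˡ) renaming (∙-cancelʳ to +-cancelʳ)
  open import Algebra.Solver.Ring.NaturalCoefficients commutativeSemiring (λ _ _ → nothing)

  *-cancelˡ-nonzero : ∀ {x u v} → ¬ (x ≈ 0#) → x * u ≈ x * v → u ≈ v
  *-cancelˡ-nonzero {x} {u} {v} x≉0 xu≈xv with inverse x x≉0
  ... | x⁻¹ , xx⁻¹≈1 = begin
    u               ≈⟨ *-identityˡ u ⟨
    1# * u          ≈⟨ *-congʳ xx⁻¹≈1 ⟨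
    (x * x⁻¹) * u   ≈⟨ solve 3 (λ x y u → (x :* y) :* u := y :* (x :* u)) refl x x⁻¹ u ⟩
    x⁻¹ * (x * u)   ≈⟨ *-congˡ xu≈xv ⟩
    x⁻¹ * (x * v)   ≈⟨ solve 3 (λ x y v → y :* (x :* v) := (x :* y) :* v) refl x x⁻¹ v ⟩
    (x * x⁻¹) * v   ≈⟨ *-congʳ xx⁻¹≈1 ⟩
    1# * v          ≈⟨ *-identityˡ v ⟩
    v               ∎

  difference⇒sum : ∀ {p q r} → p - q ≈ r → p ≈ r + q
  difference⇒sum {p} {q} {r} eq = begin
    p             ≈⟨ //-rightDividesˡ q p ⟨
    (p - q) + q   ≈⟨ +-congʳ eq ⟩
    r + q         ∎

  -- The fixed-point equation at the left end of the sequence, where the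
  -- left neighbour vanishes, forces a nonzero first term to equal 1.
  first-term-one : ∀ {x y} → ¬ (x ≈ 0#) → x * x - 0# * y ≈ x → x ≈ 1#
  first-term-one {x} {y} x≉0 fixed = *-cancelˡ-nonzero x≉0 (begin
    x * x          ≈⟨ difference⇒sum fixed ⟩
    x + 0# * y     ≈⟨ +-congˡ (zeroˡ y) ⟩
    x + 0#         ≈⟨ +-identityʳ x ⟩
    x              ≈⟨ *-identityʳ x ⟨
    x * 1#         ∎)

  -- One step of the conservation law (x, y, z, w stand for a_{m+2},
  -- a_{m+1}, a_m, a_{m-1}): given the fixed-point equations at m+1 and m,
  -- the law at m implies the law at m+1, provided a_m ≠ 0.  The identity
  -- behind it is  z·(x + y + z) + y = z + y·(y + z + w)  modulo the
  -- fixed-point equations.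
  conservation-step : ∀ {k x y z w} → ¬ (z ≈ 0#) →
    y * y ≈ y + z * x → z * z ≈ z + w * y →
    y + z + w ≈ 1# + k * z → x + y + z ≈ 1# + k * y
  conservation-step {k} {x} {y} {z} {w} z≉0 fixed₁ fixed₀ law₀ =
    *-cancelˡ-nonzero z≉0 (+-cancelʳ y _ _ (begin
      z * (x + y + z) + y
        ≈⟨ solve 3 (λ x y z → z :* (x :+ y :+ z) :+ y := (y :+ z :* x) :+ z :* z :+ z :* y) refl x y z ⟩
      (y + z * x) + z * z + z * y
        ≈⟨ +-congʳ (+-cong (sym fixed₁) fixed₀) ⟩
      y * y + (z + w * y) + z * y
        ≈⟨ solve 4 (λ y z w k → y :* y :+ (z :+ w :* y) :+ z :* y := z :+ y :* (y :+ z :+ w)) refl y z w k ⟩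
      z + y * (y + z + w)
        ≈⟨ +-congˡ (*-congˡ law₀) ⟩
      z + y * (1# + k * z)
        ≈⟨ solve 3 (λ y z k → z :+ y :* (con 1 :+ k :* z) := z :* (con 1 :+ k :* y) :+ y) refl y z k ⟩
      z * (1# + k * y) + y ∎))

  recurrence-from-conservation : ∀ {c k x y z w} →
    x + y + z ≈ c + k * y → y + z + w ≈ c + k * z →
    x - k * (y - z) - w ≈ 0#
  recurrence-from-conservation {c} {k} {x} {y} {z} {w} law₁ law₀ =
    x≈y⇒x∙y⁻¹≈ε (sym (x≈z//y w (k * (y - z)) x balance))
    where
    shifted-balance : x + k * z ≈ w + k * y
    shifted-balance = +-cancelʳ (c + y + z) _ _ (begin
      x + k * z + (c + y + z)
        ≈⟨ solve 6 (λ c k x y z w → x :+ k :* z :+ (c :+ y :+ z) := (x :+ y :+ z) :+ (c :+ k :* z)) refl c k x y z w ⟩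
      (x + y + z) + (c + k * z)
        ≈⟨ +-cong law₁ (sym law₀) ⟩
      (c + k * y) + (y + z + w)
        ≈⟨ solve 6 (λ c k x y z w → (c :+ k :* y) :+ (y :+ z :+ w) := w :+ k :* y :+ (c :+ y :+ z)) refl c k x y z w ⟩
      w + k * y + (c + y + z) ∎)

    balance : w + k * (y - z) ≈ x
    balance = +-cancelʳ (k * z) _ _ (begin
      w + k * (y - z) + k * z     ≈⟨ +-assoc w _ _ ⟩
      w + (k * (y - z) + k * z)   ≈⟨ +-congˡ (distribˡ k (y - z) z) ⟨
      w + k * ((y - z) + z)       ≈⟨ +-congˡ (*-congˡ (//-rightDividesˡ z y)) ⟩
      w + k * y                   ≈⟨ shifted-balance ⟨
      x + k * z                   ∎)

zero-in-range : ∀ N → InRange N 0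
zero-in-range (just N) = fin ℕ.z≤n
zero-in-range nothing  = inf

in-range-pred : ∀ {N n} → InRange N (suc n) → InRange N n
in-range-pred (fin n<N) = fin (ℕₚ.<⇒≤ n<N)
in-range-pred inf       = inf

module FixedSequence {c ℓ} (F : Field c ℓ) (N : ℕ∞) (a : ℕ → Field.Carrier F)
  (nonvanishing : ∀ n → InRange N n → ¬ (Field._≈_ F (a n) (Field.0# F)))
  (fixed : FixedByL F N a) where
  open Field F
  open FieldFacts F
  open SetoidReasoning setoid

  A : ℤ.ℤ → Carrier
  A = extend F N a

  k : Carrier
  k = A (+ 1)

  -- The sequence shifted by two: shifted j = a_{j-2}, including the
  -- boundary values a_{-2} = a_{-1} = 0.
  shifted : ℕ → Carrier
  shifted zero          = 0#
  shifted (suc zero)    = 0#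
  shifted (suc (suc j)) = A (+ j)

  extend-agrees : ∀ {n} → InRange N n → A (+ n) ≡ a n
  extend-agrees inf = ≡.refl
  extend-agrees {n} (fin {N = M} n≤M) with n ≤ᵇ M | ℕₚ.≤⇒≤ᵇ n≤M
  ... | true | _ = ≡.refl

  nonzero : ∀ n → InRange N n → ¬ (A (+ n) ≈ 0#)
  nonzero n r = ≡.subst (λ t → ¬ (t ≈ 0#)) (≡.sym (extend-agrees r)) (nonvanishing n r)

  fixed-shifted : ∀ n →
    shifted (2 ℕ.+ n) * shifted (2 ℕ.+ n) - shifted (1 ℕ.+ n) * shifted (3 ℕ.+ n) ≈ shifted (2 ℕ.+ n)
  fixed-shifted zero    = fixed 0
  fixed-shifted (suc n) =
    ≡.subst (λ i → A (+ suc n) * A (+ suc n) - A (+ n) * A i ≈ A (+ suc n))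
            (≡.cong +_ (ℕₚ.+-comm (suc n) 1)) (fixed (suc n))

  a₀≈1 : A (+ 0) ≈ 1#
  a₀≈1 = first-term-one (nonzero 0 (zero-in-range N)) (fixed 0)

  -- The conservation law  a_{m+1} + a_m + a_{m-1} = 1 + k a_m  at m = j − 1.
  Conserved : ℕ → Set ℓ
  Conserved j = shifted (2 ℕ.+ j) + shifted (1 ℕ.+ j) + shifted j ≈ 1# + k * shifted (1 ℕ.+ j)

  conserved : ∀ j → InRange N j → Conserved j
  conserved zero _ = begin
    A (+ 0) + 0# + 0#   ≈⟨ +-identityʳ _ ⟩
    A (+ 0) + 0#        ≈⟨ +-identityʳ _ ⟩
    A (+ 0)             ≈⟨ a₀≈1 ⟩
    1#                  ≈⟨ +-identityʳ 1# ⟨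
    1# + 0#             ≈⟨ +-congˡ (zeroʳ k) ⟨
    1# + k * 0#         ∎
  conserved (suc zero) _ = begin
    k + A (+ 0) + 0#    ≈⟨ +-identityʳ _ ⟩
    k + A (+ 0)         ≈⟨ +-comm k _ ⟩
    A (+ 0) + k         ≈⟨ +-congʳ a₀≈1 ⟩
    1# + k              ≈⟨ +-congˡ (*-identityʳ k) ⟨
    1# + k * 1#         ≈⟨ +-congˡ (*-congˡ a₀≈1) ⟨
    1# + k * A (+ 0)    ∎
  conserved (suc (suc j)) r =
    conservation-step (nonzero j (in-range-pred (in-range-pred r)))
      (difference⇒sum (fixed-shifted (suc j))) (difference⇒sum (fixed-shifted j))
      (conserved (suc j) (in-range-pred r))

  -- Two consecutive instances of the law give the recurrence at index n + 1
  -- (the case split only unfolds the integer indices).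
  recurrence : ∀ n → Conserved (suc n) → Conserved n →
    A (+ suc n) - k * (A (+ suc n ℤ.- + 1) - A (+ suc n ℤ.- + 2)) - A (+ suc n ℤ.- + 3) ≈ 0#
  recurrence zero          = recurrence-from-conservation
  recurrence (suc zero)    = recurrence-from-conservation
  recurrence (suc (suc n)) = recurrence-from-conservation

corollary3p5 : ∀ {c ℓ} (F : Field c ℓ) (N : ℕ∞) (a : ℕ → Field.Carrier F) →
    (∀ n → InRange N n → ¬ (Field._≈_ F (a n) (Field.0# F))) →
    FixedByL F N a →
    let open Field F
        A = extend F N a
        k = A (+ 1)
    in (A (+ 0) ≈ 1#) ×
       (∀ (n : ℕ) → InRange N (suc n) →
          A (+ suc n) - k * (A (+ suc n ℤ.- + 1) - A (+ suc n ℤ.- + 2)) - A (+ suc n ℤ.- + 3) ≈ 0#)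
corollary3p5 F N a nonvanishing fixed =
  a₀≈1 , λ n r → recurrence n (conserved (suc n) r) (conserved n (in-range-pred r))
  where open FixedSequence F N a nonvanishing fixed
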